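{- Let $d\ge 2$ and $N>d$ be integers such that $d$ divides $N$. Then the cross-join graph $\mathcal{C}(N,d)$ of the generalized de Bruijn digraph $G_B(N,d)$ is connected.
   Context: For integers $d\ge2$ and $N>d$, the generalized de Bruijn digraph $G_B(N,d)$ has vertex set $V=\{0,1,\ldots,N-1\}$, and $(x,y)$ is an edge iff $y\equiv dx+r \pmod N$ for some $r\in\{0,1,\ldots,d-1\}$; then $y$ is a successor of $x$ and $x$ a predecessor of $y$. A de Bruijn cycle is a Hamiltonian cycle of $G_B(N,d)$ (a cycle visiting every vertex exactly once). Two distinct vertices $x_1,x_2$ are conjugate if there exist two distinct vertices $y_1,y_2$ such that $(x_1,y_1),(x_1,y_2),(x_2,y_1),(x_2,y_2)$ are all edges. A cross-join operation on a de Bruijn cycle $u$: choose a conjugate pair $x_1,x_2$ on $u$ and interchange their successors on $u$ (i.e. replace the edges $x_1\to y_1$, $x_2\to y_2$ of $u$ by $x_1\to y_2$, $x_2\to y_1$), which splits $u$ into two disjoint cycles; then choose a conjugate pair $z_1,z_2$ with $z_1$ on one of these cycles and $z_2$ on the other and interchange their successors, obtaining a new Hamiltonian cycle. Two de Bruijn cycles are (cross-join) adjacent if one can be obtained from the other by a single cross-join operation. The cross-join graph $\mathcal{C}(N,d)$ is the graph whose vertices are all de Bruijn cycles of $G_B(N,d)$, with an edge between two of them iff they are adjacent. -}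

module Defs where

open import Data.Nat using (ℕ; suc; _+_; _*_; _<_; NonZero)
open import Data.Nat.DivMod using (_%_)
open import Data.Fin using (Fin; toℕ)
open import Data.Fin.Properties using (_≟_)
open import Data.Product using (Σ; ∃; ∃-syntax; _×_; _,_)
open import Data.Sum using (_⊎_)
open import Function using (_∘_)
open import Relation.Nullary using (¬_; yes; no)
open import Relation.Binary.PropositionalEquality using (_≡_)
open import Relation.Binary.Construct.Closure.ReflexiveTransitive using (Star)

iter : {A : Set} → (A → A) → ℕ → A → A
iter f 0       x = x
iter f (suc k) x = f (iter f k x)

module _ (N d : ℕ) .{{_ : NonZero N}} where

  Edge : Fin N → Fin N → Set
  Edge x y = ∃[ r ] (r < d × toℕ y ≡ (d * toℕ x + r) % N)

  Conjugate : Fin N → Fin N → Set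
  Conjugate x₁ x₂ = ¬ (x₁ ≡ x₂) × ∃[ y₁ ] ∃[ y₂ ]
    (¬ (y₁ ≡ y₂) × Edge x₁ y₁ × Edge x₁ y₂ × Edge x₂ y₁ × Edge x₂ y₂)

  -- A cycle structure on the vertex set is recorded by its successor function.
  DeBruijnCycle : (Fin N → Fin N) → Set
  DeBruijnCycle u = (∀ x → Edge x (u x)) × (∀ x y → ∃[ k ] iter u k x ≡ y)

  swapSucc : (Fin N → Fin N) → Fin N → Fin N → (Fin N → Fin N)
  swapSucc u x₁ x₂ x with x ≟ x₁ | x ≟ x₂
  ... | yes _ | _     = u x₂
  ... | no _  | yes _ = u x₁
  ... | no _  | no _  = u x

  ValidSwap : (Fin N → Fin N) → Fin N → Fin N → Set
  ValidSwap u x₁ x₂ = Conjugate x₁ x₂ × Edge x₁ (u x₂) × Edge x₂ (u x₁)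

  -- v is obtained from u by one cross-join operation: a swap at a conjugate pair
  -- x₁,x₂ (splitting u into two cycles), then a swap at a conjugate pair z₁,z₂
  -- lying on different cycles of the intermediate structure.
  CrossJoin : (Fin N → Fin N) → (Fin N → Fin N) → Set
  CrossJoin u v = ∃[ x₁ ] ∃[ x₂ ] ∃[ z₁ ] ∃[ z₂ ]
    ( ValidSwap u x₁ x₂
    × ValidSwap (swapSucc u x₁ x₂) z₁ z₂
    × (∀ k → ¬ (iter (swapSucc u x₁ x₂) k z₁ ≡ z₂))
    × (∀ x → v x ≡ swapSucc (swapSucc u x₁ x₂) z₁ z₂ x))

  DBCycle : Set
  DBCycle = Σ (Fin N → Fin N) DeBruijnCycle

  Adjacent : DBCycle → DBCycle → Set
  Adjacent (u , _) (v , _) = CrossJoin u v ⊎ CrossJoin v u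

  CrossJoinGraphConnected : Set
  CrossJoinGraphConnected = (u v : DBCycle) → Star Adjacent u v

module Submission where

-- Fix a target de Bruijn cycle v.  If a de Bruijn cycle u differs from v at
-- a vertex x, one cross-join turns u into a cycle that agrees with v at x and
-- wherever u already did:  let x′ be the u-predecessor of v x.  Because d ∣ N,
-- the predecessors of a vertex form a block (same value of d·x mod N) and
-- vertices of a block have the same successors, so x and x′ are conjugate.
-- Exchanging their successors splits u into two cycles through x and x′; the
-- route of v from x to x′ crosses from the first to the second at some z, and
-- the predecessor z′ of v z is on the second cycle and in the block of z, so
-- exchanging the successors of z and z′ joins the two cycles again.  Repairing
-- all vertices one by one ends in a cycle with the successors of v, which is
-- adjacent to v itself (cross-join at a conjugate pair, then undo it).

open import Defs
open import Data.Nat using (ℕ; zero; suc; _+_; _*_; _∸_; _≤_; _<_; z≤n; s≤s; NonZero; >-nonZero; >-nonZero⁻¹; ≢-nonZero⁻¹)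
open import Data.Nat.Properties using (≤-trans; +-comm; +-cancelˡ-≡; +-monoʳ-<; *-monoˡ-≤; *-cancelʳ-<; *-comm; *-zeroʳ; m*n≢0⇒m≢0; m+n∸n≡m; m<m*n; <-≤-trans; module ≤-Reasoning)
open import Data.Nat.DivMod using (_%_; %-distribˡ-+; m<n⇒m%n≡m; m%n<n; n%n≡0; [m+kn]%n≡m%n)
open import Data.Nat.Divisibility using (_∣_; divides; %-presˡ-∣; ∣⇒≤; m∣m*n)
open import Data.Fin using (Fin; toℕ; fromℕ<)
open import Data.Fin.Properties using (_≟_; toℕ-fromℕ<)
open import Data.List using ([]; _∷_; allFin)
open import Data.List.Membership.Propositional using (_∉_)
open import Data.List.Membership.Propositional.Properties using (∈-allFin)
open import Data.List.Relation.Unary.Any using (here; there)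
open import Data.Product using (∃-syntax; _×_; _,_; proj₁; proj₂)
open import Data.Sum using (_⊎_; inj₁; inj₂; [_,_]′)
open import Data.Empty using (⊥; ⊥-elim)
open import Function using (_∘_)
open import Level using (0ℓ)
open import Relation.Nullary using (¬_; yes; no)
open import Relation.Unary using (Pred; ∅; ｛_｝; _∪_; _⊆_)
open import Relation.Binary.Definitions using (DecidableEquality)
open import Relation.Binary.PropositionalEquality using (_≡_; _≢_; refl; sym; trans; cong; subst; subst₂; module ≡-Reasoning)
open import Relation.Binary.Construct.Closure.ReflexiveTransitive using (Star; ε; _◅_; _◅◅_; map)

module Orbits {A : Set} where

  private variable
    f : A → A
    a b c x : A

  Reach : (A → A) → A → A → Set
  Reach f = Star (λ a b → f a ≡ b)

  Hamiltonian : (A → A) → Set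
  Hamiltonian f = ∀ a b → Reach f a b

  OnCycle : (A → A) → A → Set
  OnCycle f x = Reach f (f x) x

  iter-shift : ∀ (f : A → A) k a → iter f k (f a) ≡ iter f (suc k) a
  iter-shift f zero    a = refl
  iter-shift f (suc k) a = cong f (iter-shift f k a)

  reach⇒iter : Reach f a b → ∃[ k ] iter f k a ≡ b
  reach⇒iter ε = 0 , refl
  reach⇒iter {f = f} {a = a} (refl ◅ r) with reach⇒iter r
  ... | k , e = suc k , trans (sym (iter-shift f k a)) e

  iter⇒reach : ∀ k → iter f k a ≡ b → Reach f a b
  iter⇒reach zero    refl = ε
  iter⇒reach (suc k) e    = iter⇒reach k refl ◅◅ (e ◅ ε)

  step-off : Reach f a b → a ≢ b → Reach f (f a) b
  step-off ε          a≢a = ⊥-elim (a≢a refl)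
  step-off (refl ◅ r) _   = r

  last-step : Reach f a b → a ≡ b ⊎ ∃[ p ] f p ≡ b
  last-step ε = inj₁ refl
  last-step (e ◅ r) with last-step r
  ... | inj₁ refl = inj₂ (_ , e)
  ... | inj₂ q    = inj₂ q

  predecessor : OnCycle f x → ∃[ p ] f p ≡ x
  predecessor {x = x} loop with last-step loop
  ... | inj₁ fx≡x = x , fx≡x
  ... | inj₂ q    = q

  advance : OnCycle f x → Reach f c x → Reach f (f c) x
  advance loop ε          = loop
  advance loop (refl ◅ r) = r

  return : OnCycle f x → Reach f x a → Reach f a x
  return {f = f} {x = x} loop = go ε
    where
      go : Reach f c x → Reach f c a → Reach f a x
      go c→x ε          = c→x
      go c→x (refl ◅ r) = go (advance loop c→x) r

  cycle-closed : OnCycle f x → Reach f x c → OnCycle f c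
  cycle-closed loop x→c = return loop (x→c ◅◅ (refl ◅ ε)) ◅◅ x→c

module Walks {A : Set} (_≟_ : DecidableEquality A) where

  open Orbits {A}

  private variable
    f g h : A → A
    a b c t p q : A
    S T : Pred A 0ℓ

  Walk : (A → A) → Pred A 0ℓ → A → A → Set
  Walk f S = Star (λ a b → ¬ S a × f a ≡ b)

  -- the two-point set {a, b}, written as the set a walk avoids after
  -- excluding first a and then b
  Pair : A → A → Pred A 0ℓ
  Pair a b = (∅ ∪ ｛ a ｝) ∪ ｛ b ｝

  left : Pair a b a
  left = inj₁ (inj₂ refl)

  right : Pair a b b
  right = inj₂ refl

  pair-swap : Pair a b ⊆ Pair b a
  pair-swap (inj₁ (inj₂ a≡c)) = inj₂ a≡c
  pair-swap (inj₂ b≡c)        = inj₁ (inj₂ b≡c)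

  pair-cases : ∀ a b c → c ≡ a ⊎ c ≡ b ⊎ ¬ Pair a b c
  pair-cases a b c with c ≟ a | c ≟ b
  ... | yes c≡a | _       = inj₁ c≡a
  ... | no _    | yes c≡b = inj₂ (inj₁ c≡b)
  ... | no c≢a  | no c≢b  = inj₂ (inj₂ λ { (inj₁ (inj₂ a≡c)) → c≢a (sym a≡c) ; (inj₂ b≡c) → c≢b (sym b≡c) })

  walk⇒reach : Walk f S a b → Reach f a b
  walk⇒reach = map (λ (_ , e) → e)

  reach⇒walk : Reach f a b → Walk f ∅ a b
  reach⇒walk = map (λ e → (λ ()) , e)

  walk-weaken : T ⊆ S → Walk f S a b → Walk f T a b
  walk-weaken T⊆S = map (λ (a∉S , e) → (λ a∈T → a∉S (T⊆S a∈T)) , e)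

  walk-stuck : S a → Walk f S a b → a ≡ b
  walk-stuck a∈S ε               = refl
  walk-stuck a∈S ((a∉S , _) ◅ _) = ⊥-elim (a∉S a∈S)

  walk-det : Walk f S p q → Walk f S p t → S q → S t → q ≡ t
  walk-det ε ε _ _ = refl
  walk-det ε ((p∉S , _) ◅ _) p∈S _ = ⊥-elim (p∉S p∈S)
  walk-det ((p∉S , _) ◅ _) ε _ p∈S = ⊥-elim (p∉S p∈S)
  walk-det ((_ , refl) ◅ r) ((_ , refl) ◅ r') q∈S t∈S = walk-det r r' q∈S t∈S

  first-visit : Walk f S a b → Walk f (S ∪ ｛ b ｝) a b
  first-visit ε = ε
  first-visit {a = a} {b = b} ((a∉S , e) ◅ r) with a ≟ b
  ... | yes refl = ε
  ... | no a≢b   = ([ a∉S , (λ b≡a → a≢b (sym b≡a)) ]′ , e) ◅ first-visit r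

  after-last : ∀ p → Walk f S a b → Walk f (S ∪ ｛ p ｝) a b ⊎ Walk f (S ∪ ｛ p ｝) (f p) b
  after-last p ε = inj₁ ε
  after-last {a = a} p ((a∉S , refl) ◅ r) with after-last p r
  ... | inj₂ r′ = inj₂ r′
  ... | inj₁ r′ with p ≟ a
  ...   | yes refl = inj₂ r′
  ...   | no p≢a   = inj₁ (([ a∉S , p≢a ]′ , refl) ◅ r′)

  approach : ∀ t o → Reach f c t → Walk f (Pair t o) c t ⊎ Walk f (Pair t o) (f o) t
  approach t o r = after-last o (first-visit (reach⇒walk r))

  depart : ∀ a b → Reach f c t →
    Walk f (Pair a b) c t ⊎ Walk f (Pair a b) (f a) t ⊎ Walk f (Pair a b) (f b) t
  depart a b r with after-last a (reach⇒walk r)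
  ... | inj₁ w = [ inj₁ , (λ w′ → inj₂ (inj₂ w′)) ]′ (after-last b w)
  ... | inj₂ w = [ (λ w′ → inj₂ (inj₁ w′)) , (λ w′ → inj₂ (inj₂ w′)) ]′ (after-last b w)

  record Exchange (f g : A → A) (a b : A) : Set where
    field
      distinct  : a ≢ b
      at-a      : g a ≡ f b
      at-b      : g b ≡ f a
      elsewhere : ∀ c → ¬ Pair a b c → g c ≡ f c

  exchange-sym : Exchange f g a b → Exchange f g b a
  exchange-sym ex = record
    { distinct  = λ b≡a → distinct (sym b≡a)
    ; at-a      = at-b
    ; at-b      = at-a
    ; elsewhere = λ c c∉ → elsewhere c (λ c∈ → c∉ (pair-swap c∈))
    }
    where open Exchange ex

  transfer : Exchange f g a b → Walk f (Pair a b) c t → Walk g (Pair a b) c t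
  transfer ex = map (λ {c} (c∉ , e) → c∉ , trans (Exchange.elsewhere ex c c∉) e)

  record TwoCycles (g : A → A) (a b : A) : Set where
    field
      cycle-a : OnCycle g a
      cycle-b : OnCycle g b
      apart   : ¬ Reach g a b
      cover   : ∀ t → Reach g a t ⊎ Reach g b t

  module _ (two : TwoCycles g a b) where
    open TwoCycles two

    exclusive : Reach g a c → Reach g b c → ⊥
    exclusive a→c b→c = apart (a→c ◅◅ return cycle-b b→c)

    two-sym : TwoCycles g b a
    two-sym = record
      { cycle-a = cycle-b
      ; cycle-b = cycle-a
      ; apart   = exclusive ε
      ; cover   = λ t → [ inj₂ , inj₁ ]′ (cover t)
      }

    rebase : Reach g a p → Reach g b q → TwoCycles g p q
    rebase a→p b→q = record
      { cycle-a = cycle-closed cycle-a a→p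
      ; cycle-b = cycle-closed cycle-b b→q
      ; apart   = λ p→q → exclusive (a→p ◅◅ p→q) b→q
      ; cover   = λ t → [ (λ a→t → inj₁ (return cycle-a a→p ◅◅ a→t))
                        , (λ b→t → inj₂ (return cycle-b b→q ◅◅ b→t)) ]′ (cover t)
      }

    crossing : {h : A → A} → Reach h a b → ∃[ z ] Reach g a z × Reach g b (h z)
    crossing {h} = go ε
      where
        go : Reach g a c → Reach h c b → ∃[ z ] Reach g a z × Reach g b (h z)
        go a→c ε = ⊥-elim (apart a→c)
        go {c = c} a→c (refl ◅ r) with cover (h c)
        ... | inj₁ a→hc = go a→hc r
        ... | inj₂ b→hc = c , a→c , b→hc

  split-return : Hamiltonian f → Exchange f g a b → Walk g (Pair a b) (f b) a
  split-return {a = a} {b = b} ham ex with approach a b (ham b a)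
  ... | inj₁ w = ⊥-elim (Exchange.distinct ex (sym (walk-stuck right w)))
  ... | inj₂ w = transfer ex w

  split-cycle : Hamiltonian f → Exchange f g a b → OnCycle g a
  split-cycle {g = g} {a = a} ham ex =
    subst (λ c → Reach g c a) (sym (Exchange.at-a ex)) (walk⇒reach (split-return ham ex))

  split : Hamiltonian f → Exchange f g a b → TwoCycles g a b
  split {f = f} {g = g} {a = a} {b = b} ham ex = record
    { cycle-a = split-cycle ham ex
    ; cycle-b = split-cycle ham (exchange-sym ex)
    ; apart   = apart
    ; cover   = cover
    }
    where
      open Exchange ex
      -- both g a = f b ↦ … ↦ a and g a ↦ … ↦ b would avoid {a, b}
      apart : ¬ Reach g a b
      apart a→b = distinct (walk-det (split-return ham ex) (walk-weaken pair-swap to-b) left right)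
        where
          to-b : Walk g (Pair b a) (f b) b
          to-b = subst (λ c → Walk g (Pair b a) c b) at-a
                   ([ (λ w → w) , (λ w → w) ]′ (approach b a (step-off a→b distinct)))
      -- follow the old cycle from a after its last visit to {a, b}
      cover : ∀ t → Reach g a t ⊎ Reach g b t
      cover t with depart a b (ham a t)
      ... | inj₁ w with walk-stuck left w
      ...   | refl = inj₁ ε
      cover t | inj₂ (inj₁ w) = inj₂ (at-b ◅ walk⇒reach (transfer ex w))
      cover t | inj₂ (inj₂ w) = inj₁ (at-a ◅ walk⇒reach (transfer ex w))

  -- a Hamiltonian cycle is injective: equal successors would be an exchange
  -- with no effect, which by split would disconnect the cycle
  hamiltonian-injective : Hamiltonian f → f a ≡ f b → a ≡ b
  hamiltonian-injective {f = f} {a = a} {b = b} ham fa≡fb with a ≟ b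
  ... | yes a≡b = a≡b
  ... | no a≢b  = ⊥-elim (TwoCycles.apart (split ham trivial) (ham a b))
    where
      trivial : Exchange f f a b
      trivial = record { distinct = a≢b ; at-a = fa≡fb ; at-b = sym fa≡fb ; elsewhere = λ _ _ → refl }

  exchange-keeps : {v : A → A} → (∀ {p q} → v p ≡ v q → p ≡ q) →
    Exchange f g a b → f b ≡ v a → ∀ c → f c ≡ v c → g c ≡ v c
  exchange-keeps {a = a} {b = b} v-inj ex fb≡va c fc≡vc with pair-cases a b c
  ... | inj₁ refl        = trans (Exchange.at-a ex) fb≡va
  ... | inj₂ (inj₁ refl) = ⊥-elim (Exchange.distinct ex (v-inj (trans (sym fb≡va) fc≡vc)))
  ... | inj₂ (inj₂ c∉)   = trans (Exchange.elsewhere ex c c∉) fc≡vc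

  exchange-twice : Exchange f g a b → Exchange g h a b → ∀ c → h c ≡ f c
  exchange-twice {a = a} {b = b} ex ex′ c with pair-cases a b c
  ... | inj₁ refl        = trans (Exchange.at-a ex′) (Exchange.at-b ex)
  ... | inj₂ (inj₁ refl) = trans (Exchange.at-b ex′) (Exchange.at-a ex)
  ... | inj₂ (inj₂ c∉)   = trans (Exchange.elsewhere ex′ c c∉) (Exchange.elsewhere ex c c∉)

  enter : TwoCycles f a b → Exchange f g a b → Reach f c a → Reach g c a
  enter two ex r with approach _ _ r
  ... | inj₁ w = walk⇒reach (transfer ex w)
  ... | inj₂ w = ⊥-elim (exclusive two ε (refl ◅ walk⇒reach w))

  -- after the exchange, a ↦ f b leads around the old cycle of b
  bridge : TwoCycles f a b → Exchange f g a b → Reach g a b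
  bridge two ex = Exchange.at-a ex ◅ enter (two-sym two) (exchange-sym ex) (TwoCycles.cycle-b two)

  join : TwoCycles f a b → Exchange f g a b → Hamiltonian g
  join {f = f} {a = a} {b = b} {g = g} two ex c t = to-a ◅◅ from-a
    where
      open TwoCycles two
      open Exchange ex
      a→b : Reach g a b
      a→b = bridge two ex
      b→a : Reach g b a
      b→a = bridge (two-sym two) (exchange-sym ex)

      to-a : Reach g c a
      to-a with cover c
      ... | inj₁ a→c = enter two ex (return cycle-a a→c)
      ... | inj₂ b→c = enter (two-sym two) (exchange-sym ex) (return cycle-b b→c) ◅◅ b→a

      from-pair : ∀ {p} → Pair a b p → Reach g a p
      from-pair (inj₁ (inj₂ refl)) = ε
      from-pair (inj₂ refl)        = a→b

      -- follow the old cycle from a or b after its last visit to {a, b}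
      leave : ∀ {p} → Pair a b p → Reach f p t → Reach g a t
      leave p∈ r with depart a b r
      ... | inj₁ w with walk-stuck p∈ w
      ...   | refl = from-pair p∈
      leave p∈ r | inj₂ (inj₁ w) = a→b ◅◅ (at-b ◅ walk⇒reach (transfer ex w))
      leave p∈ r | inj₂ (inj₂ w) = at-a ◅ walk⇒reach (transfer ex w)

      from-a : Reach g a t
      from-a = [ leave left , leave right ]′ (cover t)

module Blocks (N d : ℕ) .{{N-nonZero : NonZero N}} (2≤d : 2 ≤ d) (d∣N : d ∣ N) where

  instance
    d-nonZero : NonZero d
    d-nonZero = >-nonZero (≤-trans (s≤s z≤n) 2≤d)

  s : ℕ
  s = _∣_.quotient d∣N

  N≡sd : N ≡ s * d
  N≡sd = _∣_.equality d∣N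

  instance
    s-nonZero : NonZero s
    s-nonZero = m*n≢0⇒m≢0 s {{subst NonZero N≡sd N-nonZero}}

  -- The block of x: the successors of x are exactly block x + r for r < d.
  block : Fin N → ℕ
  block x = (d * toℕ x) % N

  block-multiple : ∀ x → ∃[ t ] block x ≡ t * d
  block-multiple x with %-presˡ-∣ (m∣m*n (toℕ x)) d∣N
  ... | divides t eq = t , eq

  block-bound : ∀ x {r} → r < d → block x + r < N
  block-bound x {r} r<d with block-multiple x
  ... | t , eq = begin-strict
    block x + r ≡⟨ cong (_+ r) eq ⟩
    t * d + r   <⟨ +-monoʳ-< (t * d) r<d ⟩
    t * d + d   ≡⟨ +-comm (t * d) d ⟩
    suc t * d   ≤⟨ *-monoˡ-≤ d t<s ⟩
    s * d       ≡⟨ sym N≡sd ⟩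
    N           ∎
    where
      open ≤-Reasoning
      t<s : t < s
      t<s = *-cancelʳ-< d t s (subst₂ _<_ eq N≡sd (m%n<n (d * toℕ x) N))

  d≤N : d ≤ N
  d≤N = ∣⇒≤ d∣N

  successor-value : ∀ x {r} → r < d → (d * toℕ x + r) % N ≡ block x + r
  successor-value x {r} r<d = begin
    (d * toℕ x + r) % N         ≡⟨ %-distribˡ-+ (d * toℕ x) r N ⟩
    (block x + r % N) % N       ≡⟨ cong (λ r′ → (block x + r′) % N) (m<n⇒m%n≡m (<-≤-trans r<d d≤N)) ⟩
    (block x + r) % N           ≡⟨ m<n⇒m%n≡m (block-bound x r<d) ⟩
    block x + r                 ∎
    where open ≡-Reasoning

  successor : ∀ x {r} → r < d → Fin N
  successor x r<d = fromℕ< (block-bound x r<d)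

  successor-edge : ∀ x {r} (r<d : r < d) → Edge N d x (successor x r<d)
  successor-edge x {r} r<d = r , r<d , trans (toℕ-fromℕ< (block-bound x r<d)) (sym (successor-value x r<d))

  block-of : ∀ {x y} → Edge N d x y → block x ≡ toℕ y ∸ toℕ y % d
  block-of {x} {y} (r , r<d , e) with block-multiple x
  ... | t , eq = begin
    block x                   ≡⟨ m+n∸n≡m (block x) r ⟨
    block x + r ∸ r           ≡⟨ cong (_∸ r) y≡ ⟨
    toℕ y ∸ r                 ≡⟨ cong (toℕ y ∸_) y%d≡r ⟨
    toℕ y ∸ toℕ y % d         ∎
    where
      open ≡-Reasoning
      y≡ : toℕ y ≡ block x + r
      y≡ = trans e (successor-value x r<d)
      y%d≡r : toℕ y % d ≡ r
      y%d≡r = begin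
        toℕ y % d         ≡⟨ cong (_% d) (trans y≡ (trans (cong (_+ r) eq) (+-comm (t * d) r))) ⟩
        (r + t * d) % d   ≡⟨ [m+kn]%n≡m%n r t d ⟩
        r % d             ≡⟨ m<n⇒m%n≡m r<d ⟩
        r                 ∎

  same-block : ∀ {x x′ y} → Edge N d x y → Edge N d x′ y → block x ≡ block x′
  same-block e e′ = trans (block-of e) (sym (block-of e′))

  move-edge : ∀ {x x′ y} → block x ≡ block x′ → Edge N d x y → Edge N d x′ y
  move-edge {x} {x′} bb (r , r<d , e) =
    r , r<d , trans e (trans (successor-value x r<d)
                        (trans (cong (_+ r) bb) (sym (successor-value x′ r<d))))

  -- distinct vertices of one block are conjugate (they share all d ≥ 2 successors)
  conjugate : ∀ {x x′} → block x ≡ block x′ → x ≢ x′ → Conjugate N d x x′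
  conjugate {x} bb x≢x′ =
    x≢x′ , successor x 0<d , successor x 1<d , distinct ,
    successor-edge x 0<d , successor-edge x 1<d ,
    move-edge bb (successor-edge x 0<d) , move-edge bb (successor-edge x 1<d)
    where
      1<d : 1 < d
      1<d = 2≤d
      0<d : 0 < d
      0<d = ≤-trans (s≤s z≤n) 2≤d
      distinct : successor x 0<d ≢ successor x 1<d
      distinct e with +-cancelˡ-≡ (block x) 0 1 (trans (sym (toℕ-fromℕ< (block-bound x 0<d)))
                        (trans (cong toℕ e) (toℕ-fromℕ< (block-bound x 1<d))))
      ... | ()

  -- two distinct vertices of block 0: the vertices 0 and s = N / d
  block-mates : ∃[ a ] ∃[ b ] a ≢ b × block a ≡ block b
  block-mates = origin , mate , origin≢mate , trans block-origin (sym block-mate)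
    where
      0<N : 0 < N
      0<N = >-nonZero⁻¹ N
      s<N : s < N
      s<N = subst (s <_) (sym N≡sd) (m<m*n s d 2≤d)
      origin mate : Fin N
      origin = fromℕ< 0<N
      mate   = fromℕ< s<N
      origin≢mate : origin ≢ mate
      origin≢mate e = ≢-nonZero⁻¹ s (trans (sym (toℕ-fromℕ< s<N)) (trans (cong toℕ (sym e)) (toℕ-fromℕ< 0<N)))
      block-origin : block origin ≡ 0
      block-origin = begin
        (d * toℕ origin) % N ≡⟨ cong (λ i → (d * i) % N) (toℕ-fromℕ< 0<N) ⟩
        (d * 0) % N          ≡⟨ cong (_% N) (*-zeroʳ d) ⟩
        0 % N                ≡⟨ m<n⇒m%n≡m 0<N ⟩
        0                    ∎
        where open ≡-Reasoning
      block-mate : block mate ≡ 0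
      block-mate = begin
        (d * toℕ mate) % N   ≡⟨ cong (λ i → (d * i) % N) (toℕ-fromℕ< s<N) ⟩
        (d * s) % N          ≡⟨ cong (_% N) (trans (*-comm d s) (sym N≡sd)) ⟩
        N % N                ≡⟨ n%n≡0 N ⟩
        0                    ∎
        where open ≡-Reasoning

module Construction (N d : ℕ) .{{_ : NonZero N}} (2≤d : 2 ≤ d) (d∣N : d ∣ N) where

  open Blocks N d 2≤d d∣N
  open Orbits
  open Walks (_≟_ {N})

  hamiltonian : ∀ {u} → DeBruijnCycle N d u → Hamiltonian u
  hamiltonian (_ , reach) a b = iter⇒reach (proj₁ (reach a b)) (proj₂ (reach a b))

  swap-exchange : ∀ {u x₁ x₂} → x₁ ≢ x₂ → Exchange u (swapSucc N d u x₁ x₂) x₁ x₂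
  swap-exchange {u} {x₁} {x₂} x₁≢x₂ = record
    { distinct = x₁≢x₂ ; at-a = at-x₁ ; at-b = at-x₂ ; elsewhere = away }
    where
      at-x₁ : swapSucc N d u x₁ x₂ x₁ ≡ u x₂
      at-x₁ with x₁ ≟ x₁
      ... | yes _    = refl
      ... | no x₁≢x₁ = ⊥-elim (x₁≢x₁ refl)
      at-x₂ : swapSucc N d u x₁ x₂ x₂ ≡ u x₁
      at-x₂ with x₂ ≟ x₁ | x₂ ≟ x₂
      ... | yes x₂≡x₁ | _       = ⊥-elim (x₁≢x₂ (sym x₂≡x₁))
      ... | no _      | yes _   = refl
      ... | no _      | no x₂≢x₂ = ⊥-elim (x₂≢x₂ refl)
      away : ∀ c → ¬ Pair x₁ x₂ c → swapSucc N d u x₁ x₂ c ≡ u c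
      away c c∉ with c ≟ x₁ | c ≟ x₂
      ... | yes c≡x₁ | _        = ⊥-elim (c∉ (inj₁ (inj₂ (sym c≡x₁))))
      ... | no _     | yes c≡x₂ = ⊥-elim (c∉ (inj₂ (sym c≡x₂)))
      ... | no _     | no _     = refl

  exchange-edges : ∀ {f g a b} → Exchange f g a b → block a ≡ block b →
    (∀ c → Edge N d c (f c)) → ∀ c → Edge N d c (g c)
  exchange-edges {a = a} {b = b} ex bb edges c with pair-cases a b c
  ... | inj₁ refl        = subst (Edge N d c) (sym (Exchange.at-a ex)) (move-edge (sym bb) (edges b))
  ... | inj₂ (inj₁ refl) = subst (Edge N d c) (sym (Exchange.at-b ex)) (move-edge bb (edges a))
  ... | inj₂ (inj₂ c∉)   = subst (Edge N d c) (sym (Exchange.elsewhere ex c c∉)) (edges c)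

  valid-swap : ∀ {u x₁ x₂} → x₁ ≢ x₂ → block x₁ ≡ block x₂ →
    (∀ c → Edge N d c (u c)) → ValidSwap N d u x₁ x₂
  valid-swap {x₁ = x₁} {x₂ = x₂} x₁≢x₂ bb edges =
    conjugate bb x₁≢x₂ , move-edge (sym bb) (edges x₂) , move-edge bb (edges x₁)

  module CrossJoinAt {u} (U : DeBruijnCycle N d u) {x₁ x₂} (x₁≢x₂ : x₁ ≢ x₂)
                     (bx : block x₁ ≡ block x₂) where

    u₁ : Fin N → Fin N
    u₁ = swapSucc N d u x₁ x₂

    ex₁ : Exchange u u₁ x₁ x₂
    ex₁ = swap-exchange x₁≢x₂

    two₁ : TwoCycles u₁ x₁ x₂
    two₁ = split (hamiltonian U) ex₁

    edges₁ : ∀ c → Edge N d c (u₁ c)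
    edges₁ = exchange-edges ex₁ bx (proj₁ U)

    module _ {z₁ z₂} (z₁-side : Reach u₁ x₁ z₁) (z₂-side : Reach u₁ x₂ z₂)
             (bz : block z₁ ≡ block z₂) where

      two₂ : TwoCycles u₁ z₁ z₂
      two₂ = rebase two₁ z₁-side z₂-side

      z₁≢z₂ : z₁ ≢ z₂
      z₁≢z₂ refl = TwoCycles.apart two₂ ε

      u₂ : Fin N → Fin N
      u₂ = swapSucc N d u₁ z₁ z₂

      ex₂ : Exchange u₁ u₂ z₁ z₂
      ex₂ = swap-exchange z₁≢z₂

      joined : DeBruijnCycle N d u₂
      joined = exchange-edges ex₂ bz edges₁ , λ a b → reach⇒iter (join two₂ ex₂ a b)

      cross-join : ∀ {w} → (∀ c → w c ≡ u₂ c) → CrossJoin N d u w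
      cross-join w≗u₂ =
        x₁ , x₂ , z₁ , z₂ , valid-swap x₁≢x₂ bx (proj₁ U) , valid-swap z₁≢z₂ bz edges₁ ,
        (λ k e → TwoCycles.apart two₂ (iter⇒reach k e)) , w≗u₂

  module Towards {v} (V : DeBruijnCycle N d v) where

    v-injective : ∀ {p q} → v p ≡ v q → p ≡ q
    v-injective = hamiltonian-injective (hamiltonian V)

    module Repair {u} (U : DeBruijnCycle N d u) (x : Fin N) (ux≢vx : u x ≢ v x) where

      pred-vx : ∃[ p ] u p ≡ v x
      pred-vx = predecessor (hamiltonian U (u (v x)) (v x))

      x′ : Fin N
      x′ = proj₁ pred-vx

      ux′≡vx : u x′ ≡ v x
      ux′≡vx = proj₂ pred-vx

      x≢x′ : x ≢ x′
      x≢x′ x≡x′ = ux≢vx (subst (λ y → u y ≡ v x) (sym x≡x′) ux′≡vx)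

      bx : block x ≡ block x′
      bx = same-block (proj₁ V x) (subst (Edge N d x′) ux′≡vx (proj₁ U x′))

      open CrossJoinAt U x≢x′ bx

      crossing-point : ∃[ z ] Reach u₁ x z × Reach u₁ x′ (v z)
      crossing-point = crossing two₁ (hamiltonian V x x′)

      z : Fin N
      z = proj₁ crossing-point

      z-side : Reach u₁ x z
      z-side = proj₁ (proj₂ crossing-point)

      x′→vz : Reach u₁ x′ (v z)
      x′→vz = proj₂ (proj₂ crossing-point)

      pred-vz : ∃[ p ] u₁ p ≡ v z
      pred-vz = predecessor (cycle-closed (TwoCycles.cycle-b two₁) x′→vz)

      z′ : Fin N
      z′ = proj₁ pred-vz

      u₁z′≡vz : u₁ z′ ≡ v z
      u₁z′≡vz = proj₂ pred-vz

      z′-side : Reach u₁ x′ z′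
      z′-side = [ (λ x→z′ → ⊥-elim (exclusive two₁ (x→z′ ◅◅ (u₁z′≡vz ◅ ε)) x′→vz)) , (λ x′→z′ → x′→z′) ]′
                  (TwoCycles.cover two₁ z′)

      bz : block z ≡ block z′
      bz = same-block (proj₁ V z) (subst (Edge N d z′) u₁z′≡vz (edges₁ z′))

      repaired : DBCycle N d
      repaired = u₂ z-side z′-side bz , joined z-side z′-side bz

      adjacent : Adjacent N d (u , U) repaired
      adjacent = inj₁ (cross-join z-side z′-side bz (λ _ → refl))

      -- the first swap repairs x, the second keeps it; neither breaks an agreement
      keeps : ∀ c → u c ≡ v c → proj₁ repaired c ≡ v c
      keeps c = exchange-keeps v-injective (ex₂ z-side z′-side bz) u₁z′≡vz c
              ∘ exchange-keeps v-injective ex₁ ux′≡vx c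

      fixes : proj₁ repaired x ≡ v x
      fixes = exchange-keeps v-injective (ex₂ z-side z′-side bz) u₁z′≡vz x
                (trans (Exchange.at-a ex₁) ux′≡vx)

    -- a cycle with the same successors as v is adjacent to v (cross-join and undo)
    reflexive : (U : DBCycle N d) → (∀ c → proj₁ U c ≡ v c) → Adjacent N d U (v , V)
    reflexive (u , U) agree =
      inj₁ (cross-join ε ε bab (λ c → trans (sym (agree c)) (sym (exchange-twice ex₁ (ex₂ ε ε bab) c))))
      where
        a b : Fin N
        a = proj₁ block-mates
        b = proj₁ (proj₂ block-mates)
        a≢b : a ≢ b
        a≢b = proj₁ (proj₂ (proj₂ block-mates))
        bab : block a ≡ block b
        bab = proj₂ (proj₂ (proj₂ block-mates))
        open CrossJoinAt U a≢b bab

    shrink : ∀ {P : Fin N → Set} {x xs} → P x → (∀ c → c ∉ x ∷ xs → P c) → ∀ c → c ∉ xs → P c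
    shrink {x = x} Px P-outside c c∉xs with c ≟ x
    ... | yes refl = Px
    ... | no c≢x   = P-outside c λ { (here c≡x) → c≢x c≡x ; (there c∈xs) → c∉xs c∈xs }

    towards : ∀ xs (U : DBCycle N d) → (∀ c → c ∉ xs → proj₁ U c ≡ v c) → Star (Adjacent N d) U (v , V)
    towards [] U agree = reflexive U (λ c → agree c λ ()) ◅ ε
    towards (x ∷ xs) (u , U) agree with u x ≟ v x
    ... | yes ux≡vx = towards xs (u , U) (shrink ux≡vx agree)
    ... | no ux≢vx  = adjacent ◅ towards xs repaired (shrink fixes (λ c c∉ → keeps c (agree c c∉)))
      where open Repair U x ux≢vx

    connected : ∀ U → Star (Adjacent N d) U (v , V)
    connected U = towards (allFin N) U (λ c c∉ → ⊥-elim (c∉ (∈-allFin c)))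

cross-join-graph-connected : (N d : ℕ) .{{_ : NonZero N}} → 2 ≤ d → d ∣ N → CrossJoinGraphConnected N d
cross-join-graph-connected N d 2≤d d∣N U (v , V) = connected U
  where open Construction N d 2≤d d∣N using (module Towards)
        open Towards V

mainTheorem1 : (d N : ℕ) → 2 ≤ d → d < N → d ∣ N → .{{_ : NonZero N}} →
    CrossJoinGraphConnected N d
mainTheorem1 d N 2≤d _ d∣N = cross-join-graph-connected N d 2≤d d∣N
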